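{- Let $\mathbf A\in\mathsf{BCRL}$ be rigid and have a proper nontrivial congruence. Then there exists a proper admissible subalgebra of $K(\mathbf A)$ whose only proper nontrivial quotient is isomorphic to $\mathbf K_3$.
   Context: $\mathsf{BCRL}$ is the variety of bounded commutative residuated lattices $(A,\vee,\wedge,\cdot,\to,0,1)$ (lattice, commutative monoid, $ab\le c$ iff $a\le b\to c$, $1$ greatest, $0$ least). $\mathbf A\in\mathsf{BCRL}$ is rigid if $|A|>2$, $\mathbf A$ is subdirectly irreducible, $\mathbf A$ has no proper subalgebras other than $\{0,1\}$, and $\mathbf A/\theta\cong\mathbf 2$ (two-element Boolean algebra) for every proper nontrivial congruence $\theta$. $K(\mathbf A)$ is the algebra on $A\times A$ with $(a,b)\vee(c,d)=(a\vee c,b\wedge d)$, $(a,b)\wedge(c,d)=(a\wedge c,b\vee d)$, $(a,b)(c,d)=(ac,(a\to d)\wedge(c\to b))$, $(a,b)\to(c,d)=((a\to c)\wedge(d\to b),ad)$, unit $(1,1)$, constant $0$ as $(0,1)$. A subalgebra $\mathbf S$ of $K(\mathbf A)$ is admissible if the elements of $S$ below $(1,1)$ are exactly all $(a,1)$, $a\in A$. $\mathbf K_3$ is the subalgebra of $K(\mathbf 2)$ with universe $\{(0,1),(1,1),(1,0)\}$. -}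

module Defs where

open import Data.Bool using (Bool; true; false; _∨_; _∧_; not)
open import Data.Product using (Σ; _×_; _,_; proj₁; proj₂)
open import Data.Sum using (_⊎_)
open import Data.Unit using (⊤)
open import Relation.Binary.PropositionalEquality using (_≡_; _≢_)
open import Relation.Nullary using (¬_)
open import Function.Bundles using (_⇔_)

record Ops (C : Set) : Set where
  field
    _⊔_ _⊓_ _·_ _⇒_ : C → C → C
    𝟘 𝟙 : C

record BCRL : Set₁ where
  field
    Carrier : Set
    ops     : Ops Carrier
  open Ops ops public
  _≤_ : Carrier → Carrier → Set
  x ≤ y = x ⊔ y ≡ y
  field
    ⊔-comm  : ∀ x y → x ⊔ y ≡ y ⊔ x
    ⊓-comm  : ∀ x y → x ⊓ y ≡ y ⊓ x
    ⊔-assoc : ∀ x y z → (x ⊔ y) ⊔ z ≡ x ⊔ (y ⊔ z)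
    ⊓-assoc : ∀ x y z → (x ⊓ y) ⊓ z ≡ x ⊓ (y ⊓ z)
    ⊔-absorb : ∀ x y → x ⊔ (x ⊓ y) ≡ x
    ⊓-absorb : ∀ x y → x ⊓ (x ⊔ y) ≡ x
    ·-comm  : ∀ x y → x · y ≡ y · x
    ·-assoc : ∀ x y z → (x · y) · z ≡ x · (y · z)
    ·-unit  : ∀ x → x · 𝟙 ≡ x
    residuation : ∀ x y z → ((x · y) ≤ z) ⇔ (x ≤ (y ⇒ z))
    top     : ∀ x → x ≤ 𝟙
    bottom  : ∀ x → 𝟘 ≤ x

-- Universal-algebra notions relative to a "universe" predicate U on the
-- carrier (U = everything for an algebra itself, U = S for a subalgebra S).

Full : {C : Set} → C → Set
Full _ = ⊤

module _ {C : Set} (O : Ops C) where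
  open Ops O

  IsSubuniverse : (U P : C → Set) → Set
  IsSubuniverse U P =
      (∀ x → P x → U x)
    × P 𝟘 × P 𝟙
    × (∀ x y → P x → P y → P (x ⊔ y))
    × (∀ x y → P x → P y → P (x ⊓ y))
    × (∀ x y → P x → P y → P (x · y))
    × (∀ x y → P x → P y → P (x ⇒ y))

  IsCongruence : (U : C → Set) → (C → C → Set) → Set
  IsCongruence U θ =
      (∀ x → U x → θ x x)
    × (∀ x y → U x → U y → θ x y → θ y x)
    × (∀ x y z → U x → U y → U z → θ x y → θ y z → θ x z)
    × (∀ x x' y y' → U x → U x' → U y → U y' → θ x x' → θ y y' → θ (x ⊔ y) (x' ⊔ y'))
    × (∀ x x' y y' → U x → U x' → U y → U y' → θ x x' → θ y y' → θ (x ⊓ y) (x' ⊓ y'))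
    × (∀ x x' y y' → U x → U x' → U y → U y' → θ x x' → θ y y' → θ (x · y) (x' · y'))
    × (∀ x x' y y' → U x → U x' → U y → U y' → θ x x' → θ y y' → θ (x ⇒ y) (x' ⇒ y'))

  Proper : (U : C → Set) → (C → C → Set) → Set
  Proper U θ = ¬ (∀ x y → U x → U y → θ x y)

  Nontrivial : (U : C → Set) → (C → C → Set) → Set
  Nontrivial U θ = ¬ (∀ x y → U x → U y → θ x y → x ≡ y)

  -- (U / θ) ≅ (the algebra on D with operations O' and universe V):
  -- a surjective homomorphism U → V whose kernel is exactly θ.
  QuotientIso : (U : C → Set) → (C → C → Set) → {D : Set} → Ops D → (D → Set) → Set
  QuotientIso U θ {D} O' V = Σ (C → D) λ f →
      (∀ x → U x → V (f x))
    × (∀ d → V d → Σ C λ x → U x × f x ≡ d)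
    × (∀ x y → U x → U y → (θ x y ⇔ (f x ≡ f y)))
    × f 𝟘 ≡ Ops.𝟘 O' × f 𝟙 ≡ Ops.𝟙 O'
    × (∀ x y → U x → U y → f (x ⊔ y) ≡ Ops._⊔_ O' (f x) (f y))
    × (∀ x y → U x → U y → f (x ⊓ y) ≡ Ops._⊓_ O' (f x) (f y))
    × (∀ x y → U x → U y → f (x · y) ≡ Ops._·_ O' (f x) (f y))
    × (∀ x y → U x → U y → f (x ⇒ y) ≡ Ops._⇒_ O' (f x) (f y))

𝟚 : Ops Bool
𝟚 = record
  { _⊔_ = _∨_ ; _⊓_ = _∧_ ; _·_ = _∧_ ; _⇒_ = λ a b → not a ∨ b
  ; 𝟘 = false ; 𝟙 = true }

K : {C : Set} → Ops C → Ops (C × C)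
K O = record
  { _⊔_ = λ p q → (proj₁ p ⊔ proj₁ q , proj₂ p ⊓ proj₂ q)
  ; _⊓_ = λ p q → (proj₁ p ⊓ proj₁ q , proj₂ p ⊔ proj₂ q)
  ; _·_ = λ p q → (proj₁ p · proj₁ q , (proj₁ p ⇒ proj₂ q) ⊓ (proj₁ q ⇒ proj₂ p))
  ; _⇒_ = λ p q → ((proj₁ p ⇒ proj₁ q) ⊓ (proj₂ q ⇒ proj₂ p) , proj₁ p · proj₂ q)
  ; 𝟘 = (𝟘 , 𝟙)
  ; 𝟙 = (𝟙 , 𝟙) }
  where open Ops O

_≤K_ : {C : Set} {O : Ops C} → C × C → C × C → Set
_≤K_ {O = O} p q = Ops._⊔_ (K O) p q ≡ q

Admissible : {C : Set} → Ops C → (C × C → Set) → Set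
Admissible {C} O S =
    (∀ p → S p → _≤K_ {O = O} p (Ops.𝟙 (K O)) → Σ C λ a → p ≡ (a , Ops.𝟙 O))
  × (∀ a → S (a , Ops.𝟙 O))

K₃ : Bool × Bool → Set
K₃ p = (p ≡ (false , true)) ⊎ ((p ≡ (true , true)) ⊎ (p ≡ (true , false)))

module _ (A : BCRL) where
  open BCRL A

  SubdirectlyIrreducible : Set₁
  SubdirectlyIrreducible = Σ Carrier λ a → Σ Carrier λ b → a ≢ b ×
    (∀ θ → IsCongruence ops Full θ → Nontrivial ops Full θ → θ a b)

  Rigid : Set₁
  Rigid =
      (Σ Carrier λ a → Σ Carrier λ b → Σ Carrier λ c → a ≢ b × a ≢ c × b ≢ c)
    × SubdirectlyIrreducible
    × (∀ P → IsSubuniverse ops Full P → ¬ (∀ x → P x) →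
         ∀ x → P x → (x ≡ 𝟘) ⊎ (x ≡ 𝟙))
    × (∀ θ → IsCongruence ops Full θ → Proper ops Full θ → Nontrivial ops Full θ →
         QuotientIso ops Full θ 𝟚 Full)

{-# OPTIONS --safe #-}
module Submission where

open import Defs
open import Data.Bool using (Bool; true; false; T; _∨_)
open import Data.Product using (Σ; _×_; _,_; proj₁; proj₂; swap)
open import Data.Product.Properties using (×-≡,≡↔≡)
open import Data.Product.Function.NonDependent.Propositional using (_×-⇔_)
open import Data.Sum using (_⊎_; inj₁; inj₂)
open import Data.Unit using (tt)
open import Function.Bundles using (_⇔_; Equivalence; mk⇔)
open import Function.Properties.Inverse using (↔⇒⇔)
import Function.Properties.Equivalence as ⇔
open import Relation.Nullary using (¬_)
open import Relation.Binary.PropositionalEquality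

-- Let h : A → 𝟚 be the quotient map of the given congruence. In a rigid A every
-- proper nontrivial congruence is ker h: the meet of two of them still contains
-- the monolith, so it is again proper and nontrivial and has exactly the two
-- classes of 0 and 1, which therefore are the classes of all three.
-- Take S to be the preimage of K₃ under the homomorphism K(h) : K(A) → K(𝟚).
-- A congruence θ of S is determined by its trace on the copy {(a,1)} of A,
-- because (a,b) ⊓ (1,1) = (a,1), (a,b) ⇒ (1,1) = (b,a), and (a,b), (c,d) are
-- both θ-related to (a ∨ c, b ∨ d) once their components are. So a proper
-- nontrivial θ is ker K(h) restricted to S, and K(h) maps S onto K₃.

module BCRLProperties (A : BCRL) where
  open BCRL A
  open Equivalence

  ⊔-idem : ∀ x → x ⊔ x ≡ x
  ⊔-idem x = trans (cong (x ⊔_) (sym (⊓-absorb x x))) (⊔-absorb x (x ⊔ x))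

  ⊓-idem : ∀ x → x ⊓ x ≡ x
  ⊓-idem x = trans (cong (x ⊓_) (sym (⊔-absorb x x))) (⊓-absorb x (x ⊓ x))

  ⊓-identityʳ : ∀ x → x ⊓ 𝟙 ≡ x
  ⊓-identityʳ x = trans (cong (x ⊓_) (sym (top x))) (⊓-absorb x 𝟙)

  ⊓-identityˡ : ∀ x → 𝟙 ⊓ x ≡ x
  ⊓-identityˡ x = trans (⊓-comm 𝟙 x) (⊓-identityʳ x)

  ≤-antisym : ∀ {x y} → x ≤ y → y ≤ x → x ≡ y
  ≤-antisym {x} {y} x≤y y≤x = trans (sym y≤x) (trans (⊔-comm y x) x≤y)

  ≤-refl : ∀ x → x ≤ x
  ≤-refl = ⊔-idem

  ⇒-zeroʳ : ∀ x → x ⇒ 𝟙 ≡ 𝟙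
  ⇒-zeroʳ x = ≤-antisym (top (x ⇒ 𝟙)) (to (residuation 𝟙 x 𝟙) (top (𝟙 · x)))

  ⇒-identityˡ : ∀ x → 𝟙 ⇒ x ≡ x
  ⇒-identityˡ x = ≤-antisym 𝟙⇒x≤x x≤𝟙⇒x
    where
    𝟙⇒x≤x : (𝟙 ⇒ x) ≤ x
    𝟙⇒x≤x = subst (_≤ x) (·-unit (𝟙 ⇒ x)) (from (residuation (𝟙 ⇒ x) 𝟙 x) (≤-refl (𝟙 ⇒ x)))

    x≤𝟙⇒x : x ≤ (𝟙 ⇒ x)
    x≤𝟙⇒x = to (residuation x 𝟙 x) (subst (_≤ x) (sym (·-unit x)) (≤-refl x))

record IsHomomorphism {C D : Set} (O : Ops C) (O' : Ops D) (f : C → D) : Set where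
  private
    module O = Ops O
    module O' = Ops O'
  field
    𝟘-homo : f O.𝟘 ≡ O'.𝟘
    𝟙-homo : f O.𝟙 ≡ O'.𝟙
    ⊔-homo : ∀ x y → f (x O.⊔ y) ≡ f x O'.⊔ f y
    ⊓-homo : ∀ x y → f (x O.⊓ y) ≡ f x O'.⊓ f y
    ·-homo : ∀ x y → f (x O.· y) ≡ f x O'.· f y
    ⇒-homo : ∀ x y → f (x O.⇒ y) ≡ f x O'.⇒ f y

module CongruenceProperties {C : Set} {O : Ops C} {U : C → Set} {θ : C → C → Set}
                            (θ-cong : IsCongruence O U θ) where
  open Ops O

  refl′ : ∀ {x} → U x → θ x x
  refl′ {x} = proj₁ θ-cong x

  sym′ : ∀ {x y} → U x → U y → θ x y → θ y x
  sym′ {x} {y} = proj₁ (proj₂ θ-cong) x y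

  trans′ : ∀ {x y z} → U x → U y → U z → θ x y → θ y z → θ x z
  trans′ {x} {y} {z} = proj₁ (proj₂ (proj₂ θ-cong)) x y z

  ⊔-cong : ∀ {x x' y y'} → U x → U x' → U y → U y' → θ x x' → θ y y' → θ (x ⊔ y) (x' ⊔ y')
  ⊔-cong {x} {x'} {y} {y'} = proj₁ (proj₂ (proj₂ (proj₂ θ-cong))) x x' y y'

  ⊓-cong : ∀ {x x' y y'} → U x → U x' → U y → U y' → θ x x' → θ y y' → θ (x ⊓ y) (x' ⊓ y')
  ⊓-cong {x} {x'} {y} {y'} = proj₁ (proj₂ (proj₂ (proj₂ (proj₂ θ-cong)))) x x' y y'

  ·-cong : ∀ {x x' y y'} → U x → U x' → U y → U y' → θ x x' → θ y y' → θ (x · y) (x' · y')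
  ·-cong {x} {x'} {y} {y'} = proj₁ (proj₂ (proj₂ (proj₂ (proj₂ (proj₂ θ-cong))))) x x' y y'

  ⇒-cong : ∀ {x x' y y'} → U x → U x' → U y → U y' → θ x x' → θ y y' → θ (x ⇒ y) (x' ⇒ y')
  ⇒-cong {x} {x'} {y} {y'} = proj₂ (proj₂ (proj₂ (proj₂ (proj₂ (proj₂ θ-cong))))) x x' y y'

module _ {C : Set} {O : Ops C} {U : C → Set} where

  ∩-isCongruence : ∀ {ψ φ} → IsCongruence O U ψ → IsCongruence O U φ →
                   IsCongruence O U (λ x y → ψ x y × φ x y)
  ∩-isCongruence {ψ} {φ} ψ-cong φ-cong =
      (λ _ u → Ψ.refl′ u , Φ.refl′ u)
    , (λ _ _ u v (s , t) → Ψ.sym′ u v s , Φ.sym′ u v t)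
    , (λ _ _ _ u v w (s , t) (s' , t') → Ψ.trans′ u v w s s' , Φ.trans′ u v w t t')
    , (λ _ _ _ _ u u' v v' (s , t) (s' , t') → Ψ.⊔-cong u u' v v' s s' , Φ.⊔-cong u u' v v' t t')
    , (λ _ _ _ _ u u' v v' (s , t) (s' , t') → Ψ.⊓-cong u u' v v' s s' , Φ.⊓-cong u u' v v' t t')
    , (λ _ _ _ _ u u' v v' (s , t) (s' , t') → Ψ.·-cong u u' v v' s s' , Φ.·-cong u u' v v' t t')
    , (λ _ _ _ _ u u' v v' (s , t) (s' , t') → Ψ.⇒-cong u u' v v' s s' , Φ.⇒-cong u u' v v' t t')
    where
    module Ψ = CongruenceProperties {O = O} {U} {ψ} ψ-cong
    module Φ = CongruenceProperties {O = O} {U} {φ} φ-cong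

module _ {C D : Set} {O : Ops C} {O' : Ops D} {f : C → D} (f-homo : IsHomomorphism O O' f) where
  open IsHomomorphism f-homo
  open Ops O
  private module O' = Ops O'

  kernel-isCongruence : ∀ {U} → IsCongruence O U (λ x y → f x ≡ f y)
  kernel-isCongruence =
      (λ _ _ → refl)
    , (λ _ _ _ _ → sym)
    , (λ _ _ _ _ _ _ → trans)
    , (λ _ _ _ _ _ _ _ _ → respects _⊔_ O'._⊔_ ⊔-homo)
    , (λ _ _ _ _ _ _ _ _ → respects _⊓_ O'._⊓_ ⊓-homo)
    , (λ _ _ _ _ _ _ _ _ → respects _·_ O'._·_ ·-homo)
    , (λ _ _ _ _ _ _ _ _ → respects _⇒_ O'._⇒_ ⇒-homo)
    where
    respects : ∀ (_∙_ : C → C → C) (_∘_ : D → D → D) → (∀ x y → f (x ∙ y) ≡ f x ∘ f y) →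
               ∀ {x x' y y'} → f x ≡ f x' → f y ≡ f y' → f (x ∙ y) ≡ f (x' ∙ y')
    respects _∙_ _∘_ homo {x} {x'} {y} {y'} s t =
      trans (homo x y) (trans (cong₂ _∘_ s t) (sym (homo x' y')))

  preimage-isSubuniverse : ∀ {V} → IsSubuniverse O' Full V → IsSubuniverse O Full (λ x → V (f x))
  preimage-isSubuniverse {V} (_ , V𝟘 , V𝟙 , V⊔ , V⊓ , V· , V⇒) =
      (λ _ _ → tt)
    , subst V (sym 𝟘-homo) V𝟘
    , subst V (sym 𝟙-homo) V𝟙
    , (λ x y u v → subst V (sym (⊔-homo x y)) (V⊔ _ _ u v))
    , (λ x y u v → subst V (sym (⊓-homo x y)) (V⊓ _ _ u v))
    , (λ x y u v → subst V (sym (·-homo x y)) (V· _ _ u v))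
    , (λ x y u v → subst V (sym (⇒-homo x y)) (V⇒ _ _ u v))

  homomorphism⇒QuotientIso : ∀ {U θ V} → (∀ x → U x → V (f x)) →
    (∀ d → V d → Σ C λ x → U x × f x ≡ d) →
    (∀ x y → U x → U y → θ x y ⇔ (f x ≡ f y)) →
    QuotientIso O U θ O' V
  homomorphism⇒QuotientIso into onto kernel =
    f , into , onto , kernel , 𝟘-homo , 𝟙-homo
    , (λ x y _ _ → ⊔-homo x y) , (λ x y _ _ → ⊓-homo x y)
    , (λ x y _ _ → ·-homo x y) , (λ x y _ _ → ⇒-homo x y)

module _ {C D : Set} {O : Ops C} {θ : C → C → Set} {O' : Ops D} where

  quotientMap-isHomomorphism : (I : QuotientIso O Full θ O' Full) → IsHomomorphism O O' (proj₁ I)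
  quotientMap-isHomomorphism (_ , _ , _ , _ , f𝟘 , f𝟙 , f⊔ , f⊓ , f· , f⇒) = record
    { 𝟘-homo = f𝟘 ; 𝟙-homo = f𝟙
    ; ⊔-homo = λ x y → f⊔ x y tt tt ; ⊓-homo = λ x y → f⊓ x y tt tt
    ; ·-homo = λ x y → f· x y tt tt ; ⇒-homo = λ x y → f⇒ x y tt tt }

  quotientMap-kernel : (I : QuotientIso O Full θ O' Full) → ∀ x y → θ x y ⇔ (proj₁ I x ≡ proj₁ I y)
  quotientMap-kernel (_ , _ , _ , kernel , _) x y = kernel x y tt tt

module _ {C : Set} {O : Ops C} {θ : C → C → Set} (I : QuotientIso O Full θ 𝟚 Full) where
  open Ops O
  open Equivalence
  private
    f = proj₁ I
    module F = IsHomomorphism (quotientMap-isHomomorphism {O' = 𝟚} I)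
    kernel = quotientMap-kernel {O = O} {θ = θ} {O' = 𝟚} I

  𝟚-quotient-classes : ∀ x → θ x 𝟘 ⊎ θ x 𝟙
  𝟚-quotient-classes x with f x in eq
  ... | false = inj₁ (from (kernel x 𝟘) (trans eq (sym F.𝟘-homo)))
  ... | true  = inj₂ (from (kernel x 𝟙) (trans eq (sym F.𝟙-homo)))

  quotientMap-𝟘-class : ∀ {x} → θ x 𝟘 → f x ≡ false
  quotientMap-𝟘-class {x} t = trans (to (kernel x 𝟘) t) F.𝟘-homo

  quotientMap-𝟙-class : ∀ {x} → θ x 𝟙 → f x ≡ true
  quotientMap-𝟙-class {x} t = trans (to (kernel x 𝟙) t) F.𝟙-homo

IsProperNontrivialCongruence : {C : Set} → Ops C → (C → Set) → (C → C → Set) → Set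
IsProperNontrivialCongruence O U θ = IsCongruence O U θ × Proper O U θ × Nontrivial O U θ

module RigidProperties (A : BCRL) (rigid : Rigid A) where
  open BCRL A

  quotient : ∀ {ψ} → IsProperNontrivialCongruence ops Full ψ → QuotientIso ops Full ψ 𝟚 Full
  quotient {ψ} (c , p , n) = proj₂ (proj₂ (proj₂ rigid)) ψ c p n

  quotientMap : ∀ {ψ} → IsProperNontrivialCongruence ops Full ψ → Carrier → Bool
  quotientMap ψ-pnc = proj₁ (quotient ψ-pnc)

  quotientMap-surjective : ∀ {ψ} (ψ-pnc : IsProperNontrivialCongruence ops Full ψ) →
    ∀ d → Σ Carrier λ x → quotientMap ψ-pnc x ≡ d
  quotientMap-surjective ψ-pnc d with proj₁ (proj₂ (proj₂ (quotient ψ-pnc))) d tt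
  ... | x , _ , fx≡d = x , fx≡d

  quotientMap-isKernel : ∀ {ψ} (ψ-pnc : IsProperNontrivialCongruence ops Full ψ) →
    ∀ x y → ψ x y ⇔ (quotientMap ψ-pnc x ≡ quotientMap ψ-pnc y)
  quotientMap-isKernel {ψ} ψ-pnc = quotientMap-kernel {O = ops} {θ = ψ} {O' = 𝟚} (quotient ψ-pnc)

  ∩-isProperNontrivialCongruence : ∀ {ψ φ} →
    IsProperNontrivialCongruence ops Full ψ → IsProperNontrivialCongruence ops Full φ →
    IsProperNontrivialCongruence ops Full (λ x y → ψ x y × φ x y)
  ∩-isProperNontrivialCongruence {ψ} {φ} (ψ-c , ψ-p , ψ-n) (φ-c , φ-p , φ-n) =
      ∩-isCongruence {O = ops} {Full} {ψ} {φ} ψ-c φ-c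
    , (λ total → ψ-p (λ x y u v → proj₁ (total x y u v)))
    , (λ discrete → m₁≢m₂ (discrete m₁ m₂ tt tt (inMonolith ψ-c ψ-n , inMonolith φ-c φ-n)))
    where
    m₁ = proj₁ (proj₁ (proj₂ rigid))
    m₂ = proj₁ (proj₂ (proj₁ (proj₂ rigid)))
    m₁≢m₂ = proj₁ (proj₂ (proj₂ (proj₁ (proj₂ rigid))))
    inMonolith : ∀ {θ} → IsCongruence ops Full θ → Nontrivial ops Full θ → θ m₁ m₂
    inMonolith {θ} = proj₂ (proj₂ (proj₂ (proj₁ (proj₂ rigid)))) θ

  quotientMaps-agree : ∀ {ψ φ} →
    (ψ-pnc : IsProperNontrivialCongruence ops Full ψ) (φ-pnc : IsProperNontrivialCongruence ops Full φ) →
    ∀ x → quotientMap ψ-pnc x ≡ quotientMap φ-pnc x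
  quotientMaps-agree ψ-pnc φ-pnc x
    with 𝟚-quotient-classes (quotient (∩-isProperNontrivialCongruence ψ-pnc φ-pnc)) x
  ... | inj₁ (ψx𝟘 , φx𝟘) =
    trans (quotientMap-𝟘-class (quotient ψ-pnc) ψx𝟘) (sym (quotientMap-𝟘-class (quotient φ-pnc) φx𝟘))
  ... | inj₂ (ψx𝟙 , φx𝟙) =
    trans (quotientMap-𝟙-class (quotient ψ-pnc) ψx𝟙) (sym (quotientMap-𝟙-class (quotient φ-pnc) φx𝟙))

  properNontrivial-isKernel : ∀ {ψ φ} →
    (φ-pnc : IsProperNontrivialCongruence ops Full φ) → IsProperNontrivialCongruence ops Full ψ →
    ∀ x y → ψ x y ⇔ (quotientMap φ-pnc x ≡ quotientMap φ-pnc y)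
  properNontrivial-isKernel φ-pnc ψ-pnc x y =
    ⇔.trans (quotientMap-isKernel ψ-pnc x y)
            (mk⇔ (λ e → trans (sym (agree x)) (trans e (agree y)))
                 (λ e → trans (agree x) (trans e (sym (agree y)))))
    where
    agree = quotientMaps-agree ψ-pnc φ-pnc

K-map : {C D : Set} → (C → D) → C × C → D × D
K-map f (a , b) = (f a , f b)

K-map-isHomomorphism : {C D : Set} {O : Ops C} {O' : Ops D} {f : C → D} →
  IsHomomorphism O O' f → IsHomomorphism (K O) (K O') (K-map f)
K-map-isHomomorphism {O' = O'} f-homo = record
  { 𝟘-homo = cong₂ _,_ 𝟘-homo 𝟙-homo
  ; 𝟙-homo = cong₂ _,_ 𝟙-homo 𝟙-homo
  ; ⊔-homo = λ _ _ → cong₂ _,_ (⊔-homo _ _) (⊓-homo _ _)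
  ; ⊓-homo = λ _ _ → cong₂ _,_ (⊓-homo _ _) (⊔-homo _ _)
  ; ·-homo = λ _ _ → cong₂ _,_ (·-homo _ _) (trans (⊓-homo _ _) (cong₂ O'._⊓_ (⇒-homo _ _) (⇒-homo _ _)))
  ; ⇒-homo = λ _ _ → cong₂ _,_ (trans (⊓-homo _ _) (cong₂ O'._⊓_ (⇒-homo _ _) (⇒-homo _ _))) (·-homo _ _)
  }
  where
  open IsHomomorphism f-homo
  module O' = Ops O'

K-map-surjective : {C D : Set} {f : C → D} → (∀ d → Σ C λ x → f x ≡ d) →
  ∀ e → Σ (C × C) λ p → K-map f p ≡ e
K-map-surjective onto (d , d') =
  (proj₁ (onto d) , proj₁ (onto d')) , cong₂ _,_ (proj₂ (onto d)) (proj₂ (onto d'))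

isK₃ : Bool × Bool → Bool
isK₃ (x , y) = x ∨ y

T-isK₃⇒K₃ : ∀ p → T (isK₃ p) → K₃ p
T-isK₃⇒K₃ (false , true)  _ = inj₁ refl
T-isK₃⇒K₃ (true  , true)  _ = inj₂ (inj₁ refl)
T-isK₃⇒K₃ (true  , false) _ = inj₂ (inj₂ refl)

¬K₃-false-false : ¬ K₃ (false , false)
¬K₃-false-false (inj₁ ())
¬K₃-false-false (inj₂ (inj₁ ()))
¬K₃-false-false (inj₂ (inj₂ ()))

AllK₃ : (Bool × Bool → Set) → Set
AllK₃ P = P (false , true) × P (true , true) × P (true , false)

AllK₃-lookup : {P : Bool × Bool → Set} → AllK₃ P → ∀ {p} → K₃ p → P p
AllK₃-lookup (z , _ , _) (inj₁ refl)        = z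
AllK₃-lookup (_ , o , _) (inj₂ (inj₁ refl)) = o
AllK₃-lookup (_ , _ , t) (inj₂ (inj₂ refl)) = t

-- For a concrete operation the table normalises to a product of ⊤'s, so it is
-- supplied as _ and the closure check is done by evaluation.
K₃-closedUnder : (_∙_ : Bool × Bool → Bool × Bool → Bool × Bool) →
  AllK₃ (λ p → AllK₃ λ q → T (isK₃ (p ∙ q))) → ∀ p q → K₃ p → K₃ q → K₃ (p ∙ q)
K₃-closedUnder _∙_ table p q p∈K₃ q∈K₃ =
  T-isK₃⇒K₃ (p ∙ q) (AllK₃-lookup {λ q → T (isK₃ (p ∙ q))}
                       (AllK₃-lookup {λ p → AllK₃ λ q → T (isK₃ (p ∙ q))} table p∈K₃) q∈K₃)

K₃-isSubuniverse : IsSubuniverse (K 𝟚) Full K₃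
K₃-isSubuniverse =
    (λ _ _ → tt) , inj₁ refl , inj₂ (inj₁ refl)
  , K₃-closedUnder _⊔_ _ , K₃-closedUnder _⊓_ _ , K₃-closedUnder _·_ _ , K₃-closedUnder _⇒_ _
  where open Ops (K 𝟚)

K₃-snd-true : ∀ x → K₃ (x , true)
K₃-snd-true false = inj₁ refl
K₃-snd-true true  = inj₂ (inj₁ refl)

module KProperties (A : BCRL) where
  open BCRL A
  open BCRLProperties A
  open Ops (K ops) public using ()
    renaming (_⊔_ to _⊔ₖ_; _⊓_ to _⊓ₖ_; _·_ to _·ₖ_; _⇒_ to _⇒ₖ_; 𝟘 to 𝟘ₖ; 𝟙 to 𝟙ₖ)

  ι : Carrier → Carrier × Carrier
  ι a = (a , 𝟙)

  ι-⊔ : ∀ x y → ι (x ⊔ y) ≡ ι x ⊔ₖ ι y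
  ι-⊔ x y = cong (x ⊔ y ,_) (sym (⊓-idem 𝟙))

  ι-⊓ : ∀ x y → ι (x ⊓ y) ≡ ι x ⊓ₖ ι y
  ι-⊓ x y = cong (x ⊓ y ,_) (sym (⊔-idem 𝟙))

  ι-· : ∀ x y → ι (x · y) ≡ ι x ·ₖ ι y
  ι-· x y = cong (x · y ,_) (sym (trans (cong₂ _⊓_ (⇒-zeroʳ x) (⇒-zeroʳ y)) (⊓-idem 𝟙)))

  ⊓ₖ-𝟙ₖ : ∀ p → p ⊓ₖ 𝟙ₖ ≡ ι (proj₁ p)
  ⊓ₖ-𝟙ₖ (a , b) = cong₂ _,_ (⊓-identityʳ a) (top b)

  ⇒ₖ-𝟙ₖ : ∀ p → p ⇒ₖ 𝟙ₖ ≡ swap p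
  ⇒ₖ-𝟙ₖ (a , b) = cong₂ _,_ (trans (cong₂ _⊓_ (⇒-zeroʳ a) (⇒-identityˡ b)) (⊓-identityˡ b)) (·-unit a)

  ι-⇒ : ∀ x y → ι (x ⇒ y) ≡ (ι x ⇒ₖ ι y) ⊓ₖ 𝟙ₖ
  ι-⇒ x y = sym (trans (⊓ₖ-𝟙ₖ (ι x ⇒ₖ ι y)) (cong ι (trans (cong ((x ⇒ y) ⊓_) (⇒-zeroʳ 𝟙)) (⊓-identityʳ (x ⇒ y)))))

  ⊔ₖ-ι : ∀ a b c → (a , b) ⊔ₖ ι c ≡ (a ⊔ c , b)
  ⊔ₖ-ι a b c = cong (a ⊔ c ,_) (⊓-identityʳ b)

  ≤K-𝟙ₖ⇒proj₂≡𝟙 : ∀ p → _≤K_ {O = ops} p 𝟙ₖ → proj₂ p ≡ 𝟙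
  ≤K-𝟙ₖ⇒proj₂≡𝟙 p p≤𝟙ₖ = trans (sym (⊓-identityʳ (proj₂ p))) (cong proj₂ p≤𝟙ₖ)

  ι-closed⇒Admissible : ∀ {S} → (∀ a → S (ι a)) → Admissible ops S
  ι-closed⇒Admissible S-ι = (λ p _ p≤𝟙ₖ → proj₁ p , cong (proj₁ p ,_) (≤K-𝟙ₖ⇒proj₂≡𝟙 p p≤𝟙ₖ)) , S-ι

  module ι-Closed (S : Carrier × Carrier → Set) (S-sub : IsSubuniverse (K ops) Full S)
                  (S-ι : ∀ a → S (ι a)) where

    S-⊔ : ∀ {p q} → S p → S q → S (p ⊔ₖ q)
    S-⊔ = proj₁ (proj₂ (proj₂ (proj₂ S-sub))) _ _

    S-⇒ : ∀ {p q} → S p → S q → S (p ⇒ₖ q)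
    S-⇒ = proj₂ (proj₂ (proj₂ (proj₂ (proj₂ (proj₂ S-sub))))) _ _

    S-swap : ∀ {p} → S p → S (swap p)
    S-swap {p} p∈S = subst S (⇒ₖ-𝟙ₖ p) (S-⇒ p∈S (S-ι 𝟙))

    S-⊔ι₁ : ∀ {a b} c → S (a , b) → S (a ⊔ c , b)
    S-⊔ι₁ {a} {b} c ab∈S = subst S (⊔ₖ-ι a b c) (S-⊔ ab∈S (S-ι c))

    S-⊔ι₂ : ∀ {a b} d → S (a , b) → S (a , b ⊔ d)
    S-⊔ι₂ d ab∈S = S-swap (S-⊔ι₁ d (S-swap ab∈S))

    module _ (θ : Carrier × Carrier → Carrier × Carrier → Set) (θ-cong : IsCongruence (K ops) S θ) where
      open CongruenceProperties {O = K ops} {S} {θ} θ-cong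

      θι : Carrier → Carrier → Set
      θι x y = θ (ι x) (ι y)

      θι-isCongruence : IsCongruence ops Full θι
      θι-isCongruence =
          (λ x _ → refl′ (S-ι x))
        , (λ x y _ _ → sym′ (S-ι x) (S-ι y))
        , (λ x y z _ _ _ → trans′ (S-ι x) (S-ι y) (S-ι z))
        , (λ x x' y y' _ _ _ _ s t → subst₂ θ (sym (ι-⊔ x y)) (sym (ι-⊔ x' y')) (⊔-cong (S-ι x) (S-ι x') (S-ι y) (S-ι y') s t))
        , (λ x x' y y' _ _ _ _ s t → subst₂ θ (sym (ι-⊓ x y)) (sym (ι-⊓ x' y')) (⊓-cong (S-ι x) (S-ι x') (S-ι y) (S-ι y') s t))
        , (λ x x' y y' _ _ _ _ s t → subst₂ θ (sym (ι-· x y)) (sym (ι-· x' y')) (·-cong (S-ι x) (S-ι x') (S-ι y) (S-ι y') s t))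
        , (λ x x' y y' _ _ _ _ s t → subst₂ θ (sym (ι-⇒ x y)) (sym (ι-⇒ x' y'))
             (⊓-cong (S-⇒ (S-ι x) (S-ι y)) (S-⇒ (S-ι x') (S-ι y')) (S-ι 𝟙) (S-ι 𝟙)
                     (⇒-cong (S-ι x) (S-ι x') (S-ι y) (S-ι y') s t) (refl′ (S-ι 𝟙))))

      θ⇒θι₁ : ∀ {p q} → S p → S q → θ p q → θι (proj₁ p) (proj₁ q)
      θ⇒θι₁ {p} {q} p∈S q∈S t =
        subst₂ θ (⊓ₖ-𝟙ₖ p) (⊓ₖ-𝟙ₖ q) (⊓-cong p∈S q∈S (S-ι 𝟙) (S-ι 𝟙) t (refl′ (S-ι 𝟙)))

      θ-swap : ∀ {p q} → S p → S q → θ p q → θ (swap p) (swap q)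
      θ-swap {p} {q} p∈S q∈S t =
        subst₂ θ (⇒ₖ-𝟙ₖ p) (⇒ₖ-𝟙ₖ q) (⇒-cong p∈S q∈S (S-ι 𝟙) (S-ι 𝟙) t (refl′ (S-ι 𝟙)))

      θ⇒θι₂ : ∀ {p q} → S p → S q → θ p q → θι (proj₂ p) (proj₂ q)
      θ⇒θι₂ p∈S q∈S t = θ⇒θι₁ (S-swap p∈S) (S-swap q∈S) (θ-swap p∈S q∈S t)

      θ-⊔ι₁ : ∀ {a b c} → S (a , b) → θι a c → θ (a , b) (a ⊔ c , b)
      θ-⊔ι₁ {a} {b} {c} ab∈S t =
        subst₂ θ (trans (⊔ₖ-ι a b a) (cong (_, b) (⊔-idem a))) (⊔ₖ-ι a b c)
               (⊔-cong ab∈S ab∈S (S-ι a) (S-ι c) (refl′ ab∈S) t)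

      θ-⊔ι₂ : ∀ {a b d} → S (a , b) → θι b d → θ (a , b) (a , b ⊔ d)
      θ-⊔ι₂ {d = d} ab∈S t = θ-swap (S-swap ab∈S) (S-⊔ι₁ d (S-swap ab∈S)) (θ-⊔ι₁ (S-swap ab∈S) t)

      θ-toJoin : ∀ {a b c d} → S (a , b) → θι a c → θι b d → θ (a , b) (a ⊔ c , b ⊔ d)
      θ-toJoin {c = c} {d} ab∈S s t =
        trans′ ab∈S (S-⊔ι₁ c ab∈S) (S-⊔ι₂ d (S-⊔ι₁ c ab∈S)) (θ-⊔ι₁ ab∈S s) (θ-⊔ι₂ (S-⊔ι₁ c ab∈S) t)

      θι⇒θ : ∀ {p q} → S p → S q → θι (proj₁ p) (proj₁ q) → θι (proj₂ p) (proj₂ q) → θ p q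
      θι⇒θ {a , b} {c , d} p∈S q∈S s t =
        trans′ p∈S join∈S q∈S (θ-toJoin p∈S s t)
               (sym′ q∈S join∈S (subst (θ (c , d)) (cong₂ _,_ (⊔-comm c a) (⊔-comm d b))
                                   (θ-toJoin q∈S (θι-sym s) (θι-sym t))))
        where
        join∈S = S-⊔ι₂ d (S-⊔ι₁ c p∈S)
        θι-sym : ∀ {x y} → θι x y → θι y x
        θι-sym {x} {y} = sym′ (S-ι x) (S-ι y)

      θ⇔θι×θι : ∀ {p q} → S p → S q → θ p q ⇔ (θι (proj₁ p) (proj₁ q) × θι (proj₂ p) (proj₂ q))
      θ⇔θι×θι p∈S q∈S =
        mk⇔ (λ t → θ⇒θι₁ p∈S q∈S t , θ⇒θι₂ p∈S q∈S t) (λ (s , t) → θι⇒θ p∈S q∈S s t)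

      θι-proper : Proper (K ops) S θ → Proper ops Full θι
      θι-proper θ-proper total =
        θ-proper (λ p q p∈S q∈S → θι⇒θ p∈S q∈S (total _ _ tt tt) (total _ _ tt tt))

      θι-nontrivial : Nontrivial (K ops) S θ → Nontrivial ops Full θι
      θι-nontrivial θ-nontrivial discrete =
        θ-nontrivial (λ p q p∈S q∈S t →
          cong₂ _,_ (discrete _ _ tt tt (θ⇒θι₁ p∈S q∈S t)) (discrete _ _ tt tt (θ⇒θι₂ p∈S q∈S t)))

module Construction (A : BCRL) (rigid : Rigid A) {θ₀ : BCRL.Carrier A → BCRL.Carrier A → Set}
                    (θ₀-pnc : IsProperNontrivialCongruence (BCRL.ops A) Full θ₀) where
  open BCRL A
  open KProperties A
  open RigidProperties A rigid
  open Equivalence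

  h : Carrier → Bool
  h = quotientMap θ₀-pnc

  h-homo : IsHomomorphism ops 𝟚 h
  h-homo = quotientMap-isHomomorphism (quotient θ₀-pnc)

  F : Carrier × Carrier → Bool × Bool
  F = K-map h

  F-homo : IsHomomorphism (K ops) (K 𝟚) F
  F-homo = K-map-isHomomorphism h-homo

  open IsHomomorphism h-homo using (𝟘-homo; 𝟙-homo)

  S : Carrier × Carrier → Set
  S p = K₃ (F p)

  S-sub : IsSubuniverse (K ops) Full S
  S-sub = preimage-isSubuniverse F-homo K₃-isSubuniverse

  S-ι : ∀ a → S (ι a)
  S-ι a = subst (λ v → K₃ (h a , v)) (sym 𝟙-homo) (K₃-snd-true (h a))

  S-admissible : Admissible ops S
  S-admissible = ι-closed⇒Admissible S-ι

  S-proper : ¬ (∀ p → S p)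
  S-proper all = ¬K₃-false-false (subst K₃ (cong₂ _,_ 𝟘-homo 𝟘-homo) (all (𝟘 , 𝟘)))

  kerF : Carrier × Carrier → Carrier × Carrier → Set
  kerF p q = F p ≡ F q

  kerF-isProperNontrivialCongruence : IsProperNontrivialCongruence (K ops) S kerF
  kerF-isProperNontrivialCongruence = kernel-isCongruence F-homo , proper , nontrivial
    where
    proper : Proper (K ops) S kerF
    proper total with trans (sym 𝟙-homo) (trans (cong proj₁ (total 𝟙ₖ 𝟘ₖ (S-ι 𝟙) (S-ι 𝟘))) 𝟘-homo)
    ... | ()
    nontrivial : Nontrivial (K ops) S kerF
    nontrivial discrete = proj₂ (proj₂ θ₀-pnc) (λ x y _ _ t →
      cong proj₁ (discrete (ι x) (ι y) (S-ι x) (S-ι y)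
                           (cong (_, h 𝟙) (to (quotientMap-isKernel θ₀-pnc x y) t))))

  properNontrivial⇒QuotientIso : ∀ {θ} → IsProperNontrivialCongruence (K ops) S θ →
                                 QuotientIso (K ops) S θ (K 𝟚) K₃
  properNontrivial⇒QuotientIso {θ} (θ-cong , θ-proper , θ-nontrivial) =
    homomorphism⇒QuotientIso F-homo (λ _ p∈S → p∈S) onto kernel
    where
    open ι-Closed S S-sub S-ι
    θι-pnc : IsProperNontrivialCongruence ops Full (θι θ θ-cong)
    θι-pnc = θι-isCongruence θ θ-cong , θι-proper θ θ-cong θ-proper , θι-nontrivial θ θ-cong θ-nontrivial

    θι⇔ker-h : ∀ x y → θι θ θ-cong x y ⇔ (h x ≡ h y)
    θι⇔ker-h = properNontrivial-isKernel θ₀-pnc θι-pnc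

    kernel : ∀ p q → S p → S q → θ p q ⇔ (F p ≡ F q)
    kernel p q p∈S q∈S =
      ⇔.trans (θ⇔θι×θι θ θ-cong p∈S q∈S)
              (⇔.trans (θι⇔ker-h _ _ ×-⇔ θι⇔ker-h _ _) (↔⇒⇔ ×-≡,≡↔≡))

    onto : ∀ e → K₃ e → Σ (Carrier × Carrier) λ p → S p × F p ≡ e
    onto e e∈K₃ with K-map-surjective (quotientMap-surjective θ₀-pnc) e
    ... | p , Fp≡e = p , subst K₃ (sym Fp≡e) e∈K₃ , Fp≡e

lemma2p8 : (A : BCRL) → Rigid A →
    (Σ (BCRL.Carrier A → BCRL.Carrier A → Set) λ θ →
       IsCongruence (BCRL.ops A) Full θ
       × Proper (BCRL.ops A) Full θ
       × Nontrivial (BCRL.ops A) Full θ) →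
    Σ (BCRL.Carrier A × BCRL.Carrier A → Set) λ S →
      IsSubuniverse (K (BCRL.ops A)) Full S
      × Admissible (BCRL.ops A) S
      × ¬ (∀ p → S p)
      × (Σ (BCRL.Carrier A × BCRL.Carrier A → BCRL.Carrier A × BCRL.Carrier A → Set) λ θ →
           IsCongruence (K (BCRL.ops A)) S θ
           × Proper (K (BCRL.ops A)) S θ
           × Nontrivial (K (BCRL.ops A)) S θ)
      × (∀ θ → IsCongruence (K (BCRL.ops A)) S θ
             → Proper (K (BCRL.ops A)) S θ
             → Nontrivial (K (BCRL.ops A)) S θ
             → QuotientIso (K (BCRL.ops A)) S θ (K 𝟚) K₃)
lemma2p8 A rigid (θ₀ , θ₀-pnc) =
    S , S-sub , S-admissible , S-proper
  , (kerF , kerF-isProperNontrivialCongruence)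
  , (λ θ θ-cong θ-proper θ-nontrivial → properNontrivial⇒QuotientIso (θ-cong , θ-proper , θ-nontrivial))
  where open Construction A rigid θ₀-pnc
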